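{- Let $G$ be a finite simple connected graph with $n$ vertices and $m$ edges. If $m\leq n$ and the maximum degree satisfies $\Delta=\Delta(G)\geq 3$, then $\chi_D(G)\leq \Delta+1$.
   Context: A labeling $f:V(G)\to\{1,\dots,r\}$ is proper if adjacent vertices receive different labels, and distinguishing if the only automorphism $\sigma$ of $G$ with $f(\sigma(x))=f(x)$ for all vertices $x$ is the identity. The distinguishing chromatic number $\chi_D(G)$ is the minimum $r$ such that $G$ has a labeling with $r$ labels that is both proper and distinguishing. -}

module Defs where

open import Data.Nat using (ℕ; zero; suc; _+_; _⊔_; _<ᵇ_)
open import Data.Bool using (Bool; true; false; if_then_else_; _∧_)
open import Data.Fin using (Fin; toℕ)
open import Data.List using (List; []; _∷_; foldr; allFin)
open import Data.Product using (Σ; _×_; _,_; ∃)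
open import Relation.Binary.PropositionalEquality using (_≡_; _≢_)
open import Function.Bundles using (Inverse)

record Graph (n : ℕ) : Set where
  field
    adj    : Fin n → Fin n → Bool
    sym    : ∀ u v → adj u v ≡ adj v u
    irrefl : ∀ v → adj v v ≡ false

open Graph public

Adj : ∀ {n} → Graph n → Fin n → Fin n → Set
Adj G u v = adj G u v ≡ true

countB : ∀ {A : Set} → (A → Bool) → List A → ℕ
countB p [] = 0
countB p (x ∷ xs) = if p x then suc (countB p xs) else countB p xs

degree : ∀ {n} → Graph n → Fin n → ℕ
degree {n} G v = countB (adj G v) (allFin n)

maxDegree : ∀ {n} → Graph n → ℕ
maxDegree {n} G = foldr (λ v acc → degree G v ⊔ acc) 0 (allFin n)

numEdges : ∀ {n} → Graph n → ℕ
numEdges {n} G =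
  foldr (λ u acc → countB (λ v → (toℕ u <ᵇ toℕ v) ∧ adj G u v) (allFin n) + acc)
        0 (allFin n)

data Walk {n} (G : Graph n) : Fin n → Fin n → Set where
  here : ∀ {v} → Walk G v v
  step : ∀ {u v w} → Adj G u v → Walk G v w → Walk G u w

Connected : ∀ {n} → Graph n → Set
Connected {n} G = ∀ (u v : Fin n) → Walk G u v

Automorphism : ∀ {n} → Graph n → Set
Automorphism {n} G =
  Σ (Inverse (≡-setoid (Fin n)) (≡-setoid (Fin n))) λ σ →
    ∀ u v → adj G (Inverse.to σ u) (Inverse.to σ v) ≡ adj G u v
  where open import Relation.Binary.PropositionalEquality using () renaming (setoid to ≡-setoid)

Labeling : ℕ → ℕ → Set
Labeling n r = Fin n → Fin r

Proper : ∀ {n r} → Graph n → Labeling n r → Set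
Proper G f = ∀ u v → Adj G u v → f u ≢ f v

Distinguishing : ∀ {n r} → Graph n → Labeling n r → Set
Distinguishing {n} G f =
  ∀ (σ : Automorphism G) →
    (∀ x → f (Inverse.to (Data.Product.proj₁ σ) x) ≡ f x) →
    ∀ x → Inverse.to (Data.Product.proj₁ σ) x ≡ x

χD≤ : ∀ {n} → Graph n → ℕ → Set
χD≤ {n} G r = Σ (Labeling n r) λ f → Proper G f × Distinguishing G f

-- Root the graph at r and sort the vertices into breadth-first levels. Every vertex other than r
-- has a parent on the previous level, so a BFS tree uses n − 1 edges and, as m ≤ n, at most one
-- further edge closes a cycle: a second parent edge at a single vertex x, or one horizontal edge xz
-- inside a level. Give r label 0 and colour the other vertices greedily level by level, x (or x
-- and z) first on its level, avoiding the colours of earlier neighbours and of earlier siblings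
-- (children of a common parent). Every vertex then has at most Δ − 1 forbidden colours (x and z
-- have two, which is where Δ ≥ 3 enters), so the labels 0, …, Δ suffice. A label-preserving
-- automorphism fixes r, the only vertex labelled 0, and then every vertex, by induction on the
-- level: the image of x hangs from the fixed parent of x, and distinct siblings have distinct labels.
module Submission where

open import Algebra.Properties.CommutativeMonoid.Sum as Sum using ()
open import Data.Bool using (Bool; true; false; if_then_else_; _∧_)
open import Data.Bool.Properties using (T-≡)
open import Data.Empty using (⊥; ⊥-elim)
open import Data.Fin using (Fin; zero; suc; toℕ; fromℕ<)
open import Data.Fin.Properties using (_≟_; any?; all?; ¬∀⟶∃¬; pigeonhole; toℕ<n; toℕ-fromℕ<; toℕ-injective)
open import Data.List using (List; _∷_; foldr; allFin; tabulate; length; lookup; map; filter)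
open import Data.List.Membership.Propositional using (_∈_; _∉_)
open import Data.List.Membership.Propositional.Properties using (∈-allFin; ∈-filter⁺; ∈-filter⁻; ∈-map⁺)
open import Data.List.Properties using (map-cong-local; length-map)
import Data.List.Relation.Unary.All as All
open import Data.List.Relation.Unary.Any using (here; there; index)
open import Data.List.Relation.Unary.Any.Properties using (lookup-index)
open import Data.Nat using (ℕ; zero; suc; _+_; _*_; _∸_; _≤_; _<_; _⊔_; _<ᵇ_; z≤n; s≤s; s≤s⁻¹)
open import Data.Nat.Properties hiding (_≟_)
import Data.Nat.Properties as ℕ
open import Data.Nat.Tactic.RingSolver using (solve-∀)
open import Data.List.Membership.DecPropositional ℕ._≟_ using (_∈?_)
open import Algebra.Properties.CommutativeSemigroup +-commutativeSemigroup using (x∙yz≈y∙xz)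
open import Data.Product using (∃; _×_; _,_; proj₁; proj₂)
open import Data.Sum using (_⊎_; inj₁; inj₂; [_,_]′)
open import Function using (_∘_)
open import Function.Bundles using (Equivalence; Inverse; Injection)
open import Function.Properties.Inverse using (Inverse⇒Injection)
open import Level using (Level)
open import Relation.Binary.Definitions using (tri<; tri≈; tri>)
open import Relation.Binary.PropositionalEquality
open import Relation.Nullary using (Dec; yes; no; does; ¬_; ¬?; _×-dec_; _⊎-dec_; contradiction)
open import Relation.Nullary.Decidable using (dec-true; dec-false; map′; T?; decidable-stable)
open import Relation.Unary using (Pred; Decidable; _⊆_)

open import Defs hiding (sym; irrefl)

open Sum +-0-commutativeMonoid using (sum; ∑-distrib-+; ∑-comm; sum-cong-≗)

private
  variable
    ℓ : Level
    n : ℕ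

∑-mono-≤ : {f g : Fin n → ℕ} → (∀ i → f i ≤ g i) → sum f ≤ sum g
∑-mono-≤ {zero}  f≤g = z≤n
∑-mono-≤ {suc n} f≤g = +-mono-≤ (f≤g zero) (∑-mono-≤ (f≤g ∘ suc))

∑-const-1 : ∀ n → sum {n} (λ _ → 1) ≡ n
∑-const-1 zero    = refl
∑-const-1 (suc n) = cong suc (∑-const-1 n)

∑-const-0 : ∀ n → sum {n} (λ _ → 0) ≡ 0
∑-const-0 zero    = refl
∑-const-0 (suc n) = ∑-const-0 n

∑-witness : (f : Fin n → ℕ) → 1 ≤ sum f → ∃ λ i → 1 ≤ f i
∑-witness {suc n} f 1≤sum with f zero in f₀≡
... | suc _ = zero , subst (1 ≤_) (sym f₀≡) (s≤s z≤n)
... | zero  = let i , 1≤fi = ∑-witness (f ∘ suc) 1≤sum in suc i , 1≤fi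

_without_ : (Fin n → ℕ) → Fin n → Fin n → ℕ
(f without x) i = if does (i ≟ x) then 0 else f i

without-≢ : (f : Fin n → ℕ) {x y : Fin n} → y ≢ x → (f without x) y ≡ f y
without-≢ f {x} {y} y≢x rewrite dec-false (y ≟ x) y≢x = refl

∑-without : (f : Fin n → ℕ) (x : Fin n) → f x + sum (f without x) ≡ sum f
∑-without {suc n} f zero    = refl
∑-without {suc n} f (suc x) =
  trans (x∙yz≈y∙xz (f (suc x)) (f zero) _) (cong (f zero +_) (∑-without (f ∘ suc) x))

∑-≥-point : (f : Fin n → ℕ) (x : Fin n) → f x ≤ sum f
∑-≥-point f x = subst (f x ≤_) (∑-without f x) (m≤m+n (f x) _)

∑-≥-pair : (f : Fin n → ℕ) {x y : Fin n} → x ≢ y → f x + f y ≤ sum f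
∑-≥-pair f {x} {y} x≢y = begin
  f x + f y                ≡⟨ cong (f x +_) (sym (without-≢ f (x≢y ∘ sym))) ⟩
  f x + (f without x) y    ≤⟨ +-monoʳ-≤ (f x) (∑-≥-point (f without x) y) ⟩
  f x + sum (f without x)  ≡⟨ ∑-without f x ⟩
  sum f                    ∎
  where open ≤-Reasoning

∑-≥-triple : (f : Fin n → ℕ) {x y z : Fin n} → x ≢ y → x ≢ z → y ≢ z → f x + f y + f z ≤ sum f
∑-≥-triple f {x} {y} {z} x≢y x≢z y≢z = begin
  f x + f y + f z                            ≡⟨ +-assoc (f x) (f y) (f z) ⟩
  f x + (f y + f z)                          ≡⟨ cong₂ (λ a b → f x + (a + b)) (sym (without-≢ f (x≢y ∘ sym)))
                                                                              (sym (without-≢ f (x≢z ∘ sym))) ⟩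
  f x + ((f without x) y + (f without x) z)  ≤⟨ +-monoʳ-≤ (f x) (∑-≥-pair (f without x) y≢z) ⟩
  f x + sum (f without x)                    ≡⟨ ∑-without f x ⟩
  sum f                                      ∎
  where open ≤-Reasoning

indicator : Bool → ℕ
indicator b = if b then 1 else 0

𝟙 : {A : Set ℓ} → Dec A → ℕ
𝟙 a? = indicator (does a?)

𝟙-yes : {A : Set ℓ} (a? : Dec A) → A → 𝟙 a? ≡ 1
𝟙-yes a? a rewrite dec-true a? a = refl

𝟙-no : {A : Set ℓ} (a? : Dec A) → ¬ A → 𝟙 a? ≡ 0
𝟙-no a? ¬a rewrite dec-false a? ¬a = refl

count : {P : Pred (Fin n) ℓ} → Decidable P → ℕ
count P? = sum (λ x → 𝟙 (P? x))

count-≟ : (x : Fin n) → count (_≟ x) ≡ 1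
count-≟ {suc n} zero    = cong suc (∑-const-0 n)
count-≟ {suc n} (suc x) = count-≟ x

module _ {P : Pred (Fin n) ℓ} (P? : Decidable P) where

  count-≥-1 : ∀ {x} → P x → 1 ≤ count P?
  count-≥-1 {x} px = subst (_≤ count P?) (𝟙-yes (P? x) px) (∑-≥-point _ x)

  count-≥-2 : ∀ {x y} → P x → P y → x ≢ y → 2 ≤ count P?
  count-≥-2 {x} {y} px py x≢y =
    subst (_≤ count P?) (cong₂ _+_ (𝟙-yes (P? x) px) (𝟙-yes (P? y) py)) (∑-≥-pair _ x≢y)

  count-witness : 1 ≤ count P? → ∃ P
  count-witness 1≤# with ∑-witness _ 1≤#
  ... | x , 1≤𝟙 with P? x
  ...   | yes px = x , px

  count-none : (∀ x → ¬ P x) → count P? ≡ 0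
  count-none ¬P = n≤0⇒n≡0 (subst (count P? ≤_) (∑-const-0 n)
                    (∑-mono-≤ (λ x → ≤-reflexive (𝟙-no (P? x) (¬P x)))))

  count-without : ∀ {x} → P x → suc (count (λ y → P? y ×-dec ¬? (y ≟ x))) ≤ count P?
  count-without {x} px = begin
    suc (count (λ y → P? y ×-dec ¬? (y ≟ x)))    ≤⟨ s≤s (∑-mono-≤ 𝟙-≤-without) ⟩
    suc (sum ((λ y → 𝟙 (P? y)) without x))       ≡⟨ cong (_+ sum ((λ y → 𝟙 (P? y)) without x)) (sym (𝟙-yes (P? x) px)) ⟩
    𝟙 (P? x) + sum ((λ y → 𝟙 (P? y)) without x)  ≡⟨ ∑-without _ x ⟩
    count P?                                     ∎
    where
    open ≤-Reasoning
    𝟙-≤-without : ∀ y → 𝟙 (P? y ×-dec ¬? (y ≟ x)) ≤ ((λ y → 𝟙 (P? y)) without x) y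
    𝟙-≤-without y with P? y | y ≟ x
    ... | yes _ | yes _ = z≤n
    ... | yes _ | no _  = ≤-refl
    ... | no _  | _     = z≤n

  module _ {Q : Pred (Fin n) ℓ} (Q? : Decidable Q) where

    count-mono : P ⊆ Q → count P? ≤ count Q?
    count-mono P⊆Q = ∑-mono-≤ 𝟙-mono
      where
      𝟙-mono : ∀ x → 𝟙 (P? x) ≤ 𝟙 (Q? x)
      𝟙-mono x with P? x | Q? x
      ... | yes px | no ¬qx = contradiction (P⊆Q px) ¬qx
      ... | yes _  | yes _  = ≤-refl
      ... | no _   | _      = z≤n

    module _ {R : Pred (Fin n) ℓ} (R? : Decidable R) where

      count-⊆-∪ : (∀ {x} → P x → Q x ⊎ R x) → count P? ≤ count Q? + count R?
      count-⊆-∪ P⊆Q∪R = subst (count P? ≤_) (∑-distrib-+ (λ x → 𝟙 (Q? x)) (λ x → 𝟙 (R? x))) (∑-mono-≤ 𝟙-⊆-∪)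
        where
        𝟙-⊆-∪ : ∀ x → 𝟙 (P? x) ≤ 𝟙 (Q? x) + 𝟙 (R? x)
        𝟙-⊆-∪ x with P? x | Q? x | R? x
        ... | no _   | _      | _      = z≤n
        ... | yes _  | yes _  | _      = s≤s z≤n
        ... | yes _  | no _   | yes _  = s≤s z≤n
        ... | yes px | no ¬qx | no ¬rx with P⊆Q∪R px
        ...   | inj₁ qx = contradiction qx ¬qx
        ...   | inj₂ rx = contradiction rx ¬rx

least : {P : Pred ℕ ℓ} → Decidable P → ∀ k → P k → ∃ λ m → P m × (∀ j → P j → m ≤ j)
least P? zero    p₀ = zero , p₀ , λ _ _ → z≤n
least P? (suc k) pₖ with P? zero
... | yes p₀ = zero , p₀ , λ _ _ → z≤n
... | no ¬p₀ = let m , pm , min = least (P? ∘ suc) k pₖ in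
  suc m , pm , λ { zero p₀ → contradiction p₀ ¬p₀ ; (suc j) pj → s≤s (min j pj) }

*+-<-lex : ∀ {K a a′ b b′} → b < K → a < a′ → a * K + b < a′ * K + b′
*+-<-lex {K} {a} {a′} {b} {b′} b<K a<a′ = begin-strict
  a * K + b    <⟨ +-monoʳ-< (a * K) b<K ⟩
  a * K + K    ≡⟨ +-comm (a * K) K ⟩
  suc a * K    ≤⟨ *-monoˡ-≤ K a<a′ ⟩
  a′ * K       ≤⟨ m≤m+n (a′ * K) b′ ⟩
  a′ * K + b′  ∎
  where open ≤-Reasoning

∃-fresh : (L : List ℕ) → ∃ λ k → 1 ≤ k × k ≤ suc (length L) × k ∉ L
∃-fresh L with all? (λ (j : Fin (suc (length L))) → suc (toℕ j) ∈? L)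
... | no ¬all∈ = let j , j∉L = ¬∀⟶∃¬ _ _ (λ j → suc (toℕ j) ∈? L) ¬all∈ in
  suc (toℕ j) , s≤s z≤n , toℕ<n j , j∉L
... | yes all∈ with pigeonhole (n<1+n (length L)) (λ j → index (all∈ j))
...   | i , j , i<j , same-index = contradiction (suc-injective same-value) (<⇒≢ i<j)
  where
  same-value : suc (toℕ i) ≡ suc (toℕ j)
  same-value = trans (lookup-index (all∈ i))
                     (trans (cong (lookup L) same-index) (sym (lookup-index (all∈ j))))

fresh : List ℕ → ℕ
fresh L = proj₁ (∃-fresh L)

fresh-≥1 : ∀ L → 1 ≤ fresh L
fresh-≥1 L = proj₁ (proj₂ (∃-fresh L))

fresh-≤ : ∀ L → fresh L ≤ suc (length L)
fresh-≤ L = proj₁ (proj₂ (proj₂ (∃-fresh L)))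

fresh-∉ : ∀ L → fresh L ∉ L
fresh-∉ L = proj₂ (proj₂ (proj₂ (∃-fresh L)))

length-filter-tabulate : {A : Set} {P : Pred A ℓ} (P? : Decidable P) (f : Fin n → A) →
                         length (filter P? (tabulate f)) ≡ sum (λ i → 𝟙 (P? (f i)))
length-filter-tabulate {n = zero}  P? f = refl
length-filter-tabulate {n = suc n} P? f with does (P? (f zero))
... | true  = cong suc (length-filter-tabulate P? (f ∘ suc))
... | false = length-filter-tabulate P? (f ∘ suc)

module Greedy {R : Fin n → Fin n → Set ℓ} (R? : ∀ x y → Dec (R x y))
              (rank : Fin n → ℕ) (R⇒rank< : ∀ {x y} → R x y → rank y < rank x) where

  earlier : Fin n → List (Fin n)
  earlier x = filter (R? x) (allFin n)

  -- k is recursion fuel; any k > rank x gives the same colour (colourWithin-stable).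
  colourWithin : ℕ → Fin n → ℕ
  colourWithin zero    x = 0
  colourWithin (suc k) x = fresh (map (colourWithin k) (earlier x))

  colour : Fin n → ℕ
  colour x = colourWithin (suc (rank x)) x

  map-cong-earlier : ∀ {f g : Fin n → ℕ} x → (∀ {y} → R x y → f y ≡ g y) →
                     map f (earlier x) ≡ map g (earlier x)
  map-cong-earlier x f≡g = map-cong-local (All.tabulate (f≡g ∘ proj₂ ∘ ∈-filter⁻ (R? x) {xs = allFin n}))

  colourWithin-stable : ∀ k m x → rank x < k → rank x < m → colourWithin k x ≡ colourWithin m x
  colourWithin-stable (suc k) (suc m) x rx<1+k rx<1+m = cong fresh (map-cong-earlier x λ rxy →
    let ry<rx = R⇒rank< rxy in
    colourWithin-stable k m _ (<-≤-trans ry<rx (s≤s⁻¹ rx<1+k)) (<-≤-trans ry<rx (s≤s⁻¹ rx<1+m)))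

  colour-fresh : ∀ x → colour x ≡ fresh (map colour (earlier x))
  colour-fresh x = cong fresh (map-cong-earlier x λ rxy →
    colourWithin-stable _ _ _ (R⇒rank< rxy) ≤-refl)

  colour-≢ : ∀ {x y} → R x y → colour x ≢ colour y
  colour-≢ {x} {y} rxy cx≡cy = fresh-∉ (map colour (earlier x))
    (subst (_∈ map colour (earlier x)) (trans (sym cx≡cy) (colour-fresh x))
           (∈-map⁺ colour (∈-filter⁺ (R? x) (∈-allFin y) rxy)))

  colour-≥1 : ∀ x → 1 ≤ colour x
  colour-≥1 x = subst (1 ≤_) (sym (colour-fresh x)) (fresh-≥1 (map colour (earlier x)))

  colour-≤ : ∀ x → colour x ≤ suc (count (R? x))
  colour-≤ x = subst₂ _≤_ (sym (colour-fresh x))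
                         (cong suc (trans (length-map colour (earlier x)) (length-filter-tabulate (R? x) (λ i → i))))
                         (fresh-≤ (map colour (earlier x)))

countB-tabulate : {A : Set} (p : A → Bool) (f : Fin n → A) →
                  countB p (tabulate f) ≡ sum (λ i → indicator (p (f i)))
countB-tabulate {zero}  p f = refl
countB-tabulate {suc n} p f with p (f zero)
... | true  = cong suc (countB-tabulate p (f ∘ suc))
... | false = countB-tabulate p (f ∘ suc)

foldr-+-tabulate : {A : Set} (g : A → ℕ) (f : Fin n → A) →
                   foldr (λ x acc → g x + acc) 0 (tabulate f) ≡ sum (g ∘ f)
foldr-+-tabulate {zero}  g f = refl
foldr-+-tabulate {suc n} g f = cong (g (f zero) +_) (foldr-+-tabulate g (f ∘ suc))

module _ (G : Graph n) where

  Adj? : ∀ u v → Dec (Adj G u v)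
  Adj? u v = map′ (Equivalence.to T-≡) (Equivalence.from T-≡) (T? (adj G u v))

  Adj-sym : ∀ {u v} → Adj G u v → Adj G v u
  Adj-sym {u} {v} a = trans (Graph.sym G v u) a

  Adj-irrefl : ∀ {v} → ¬ Adj G v v
  Adj-irrefl {v} a with () ← trans (sym (Graph.irrefl G v)) a

  degree≡count : ∀ v → degree G v ≡ count (Adj? v)
  degree≡count v = countB-tabulate (adj G v) (λ i → i)

  handshake : sum (degree G) ≡ numEdges G + numEdges G
  handshake = begin
    sum (degree G)                                         ≡⟨ sum-cong-≗ degree≡count ⟩
    sum (λ u → sum (λ v → indicator (adj G u v)))          ≡⟨ sum-cong-≗ (λ u → sum-cong-≗ (split u)) ⟩
    sum (λ u → sum (λ v → E u v + E v u))                  ≡⟨ sum-cong-≗ (λ u → ∑-distrib-+ (E u) (λ v → E v u)) ⟩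
    sum (λ u → sum (E u) + sum (λ v → E v u))              ≡⟨ ∑-distrib-+ (λ u → sum (E u)) (λ u → sum (λ v → E v u)) ⟩
    sum (λ u → sum (E u)) + sum (λ u → sum (λ v → E v u))  ≡⟨ cong (sum (λ u → sum (E u)) +_) (∑-comm (λ u v → E v u)) ⟩
    sum (λ u → sum (E u)) + sum (λ u → sum (E u))          ≡⟨ cong₂ _+_ numEdges≡ numEdges≡ ⟩
    numEdges G + numEdges G                                ∎
    where
    open ≡-Reasoning
    E : Fin n → Fin n → ℕ
    E u v = indicator ((toℕ u <ᵇ toℕ v) ∧ adj G u v)

    numEdges≡ : sum (λ u → sum (E u)) ≡ numEdges G
    numEdges≡ = sym (trans (foldr-+-tabulate (λ u → countB (λ v → (toℕ u <ᵇ toℕ v) ∧ adj G u v) (allFin n)) (λ i → i))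
                           (sum-cong-≗ (λ u → countB-tabulate (λ v → (toℕ u <ᵇ toℕ v) ∧ adj G u v) (λ i → i))))

    <ᵇ-true : ∀ {a b} → a < b → (a <ᵇ b) ≡ true
    <ᵇ-true {a} {b} a<b = dec-true (a <? b) a<b

    <ᵇ-false : ∀ {a b} → ¬ a < b → (a <ᵇ b) ≡ false
    <ᵇ-false {a} {b} a≮b = dec-false (a <? b) a≮b

    split : ∀ u v → indicator (adj G u v) ≡ E u v + E v u
    split u v with <-cmp (toℕ u) (toℕ v)
    ... | tri< u<v _ v≮u rewrite <ᵇ-true u<v | <ᵇ-false v≮u = sym (+-identityʳ _)
    ... | tri> u≮v _ v<u rewrite <ᵇ-false u≮v | <ᵇ-true v<u | Graph.sym G v u = refl
    ... | tri≈ _ u≡v _ rewrite toℕ-injective u≡v | <ᵇ-false (<-irrefl {toℕ v} refl) | Graph.irrefl G v = refl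

  degree≤maxDegree : ∀ v → degree G v ≤ maxDegree G
  degree≤maxDegree v = foldr-⊔-≥ (degree G) (∈-allFin v)
    where
    foldr-⊔-≥ : {A : Set} (f : A → ℕ) {xs : List A} {x : A} →
                x ∈ xs → f x ≤ foldr (λ y acc → f y ⊔ acc) 0 xs
    foldr-⊔-≥ f {y ∷ _} (here refl) = m≤m⊔n (f y) _
    foldr-⊔-≥ f {y ∷ _} (there x∈) = ≤-trans (foldr-⊔-≥ f x∈) (m≤n⊔m (f y) _)

module BreadthFirst (G : Graph n) (r : Fin n) (connected : Connected G) where

  Within : ℕ → Fin n → Set
  Within zero    v = v ≡ r
  Within (suc k) v = Within k v ⊎ ∃ λ u → Within k u × Adj G u v

  within? : ∀ k → Decidable (Within k)
  within? zero    v = v ≟ r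
  within? (suc k) v = within? k v ⊎-dec any? (λ u → within? k u ×-dec Adj? G u v)

  Within-step : ∀ {k u v} → Within k u → Adj G u v → Within (suc k) v
  Within-step wu a = inj₂ (_ , wu , a)

  walk⇒Within : ∀ {v} → Walk G v r → ∃ λ k → Within k v
  walk⇒Within here       = 0 , refl
  walk⇒Within (step a w) = let k , wk = walk⇒Within w in suc k , Within-step wk (Adj-sym G a)

  distance : ∀ v → ∃ λ m → Within m v × (∀ j → Within j v → m ≤ j)
  distance v = let k , wk = walk⇒Within (connected v r) in least (λ j → within? j v) k wk

  dist : Fin n → ℕ
  dist v = proj₁ (distance v)

  dist-within : ∀ v → Within (dist v) v
  dist-within v = proj₁ (proj₂ (distance v))

  dist-least : ∀ v j → Within j v → dist v ≤ j
  dist-least v = proj₂ (proj₂ (distance v))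

  dist-root : dist r ≡ 0
  dist-root = n≤0⇒n≡0 (dist-least r 0 refl)

  dist-adj : ∀ {u v} → Adj G u v → dist v ≤ suc (dist u)
  dist-adj {u} {v} a = dist-least v _ (Within-step (dist-within u) a)

  Parent : Fin n → Fin n → Set
  Parent u v = Adj G u v × suc (dist u) ≡ dist v

  Parent? : ∀ u v → Dec (Parent u v)
  Parent? u v = Adj? G u v ×-dec (suc (dist u) ℕ.≟ dist v)

  parent-exists : ∀ {v} → v ≢ r → ∃ λ u → Parent u v
  parent-exists {v} v≢r with dist v | dist-within v | dist-least v
  ... | zero  | v≡r              | _   = contradiction v≡r v≢r
  ... | suc k | inj₁ wk          | min = contradiction (min k wk) (<-irrefl refl)
  ... | suc k | inj₂ (u , wu , a) | min =
    u , a , cong suc (≤-antisym (dist-least u k wu) (s≤s⁻¹ (min _ (Within-step (dist-within u) a))))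

  Horizontal : Fin n → Fin n → Set
  Horizontal u v = Adj G u v × dist u ≡ dist v

  Horizontal? : ∀ u v → Dec (Horizontal u v)
  Horizontal? u v = Adj? G u v ×-dec (dist u ℕ.≟ dist v)

  adjacent-levels : ∀ {u v} → Adj G u v → Parent u v ⊎ Horizontal u v ⊎ Parent v u
  adjacent-levels {u} {v} a with <-cmp (dist u) (dist v)
  ... | tri< du<dv _ _ = inj₁ (a , ≤-antisym du<dv (dist-adj a))
  ... | tri≈ _ du≡dv _ = inj₂ (inj₁ (a , du≡dv))
  ... | tri> _ _ dv<du = inj₂ (inj₂ (Adj-sym G a , ≤-antisym dv<du (dist-adj (Adj-sym G a))))

  #parents #horizontal #children : Fin n → ℕ
  #parents v    = count (λ u → Parent? u v)
  #horizontal v = count (Horizontal? v)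
  #children v   = count (Parent? v)

  degree-split : ∀ v → degree G v ≡ #parents v + #horizontal v + #children v
  degree-split v = begin
    degree G v                                ≡⟨ degree≡count G v ⟩
    sum (λ u → 𝟙 (Adj? G v u))                ≡⟨ sum-cong-≗ split ⟩
    sum (λ u → 𝟙 (Parent? u v) + 𝟙 (Horizontal? v u) + 𝟙 (Parent? v u))
      ≡⟨ ∑-distrib-+ (λ u → 𝟙 (Parent? u v) + 𝟙 (Horizontal? v u)) (λ u → 𝟙 (Parent? v u)) ⟩
    sum (λ u → 𝟙 (Parent? u v) + 𝟙 (Horizontal? v u)) + #children v
      ≡⟨ cong (_+ #children v) (∑-distrib-+ (λ u → 𝟙 (Parent? u v)) (λ u → 𝟙 (Horizontal? v u))) ⟩
    #parents v + #horizontal v + #children v  ∎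
    where
    open ≡-Reasoning
    split : ∀ u → 𝟙 (Adj? G v u) ≡ 𝟙 (Parent? u v) + 𝟙 (Horizontal? v u) + 𝟙 (Parent? v u)
    split u with Adj? G v u
    ... | no ¬a
      rewrite 𝟙-no (Adj? G v u) ¬a
            | 𝟙-no (Parent? u v) (¬a ∘ Adj-sym G ∘ proj₁)
            | 𝟙-no (Horizontal? v u) (¬a ∘ proj₁)
            | 𝟙-no (Parent? v u) (¬a ∘ proj₁) = refl
    ... | yes a rewrite 𝟙-yes (Adj? G v u) a with adjacent-levels a
    ...   | inj₁ (_ , 1+dv≡du)
      rewrite 𝟙-no (Parent? u v) (λ (_ , 1+du≡dv) → <-asym (≤-reflexive 1+dv≡du) (≤-reflexive 1+du≡dv))
            | 𝟙-no (Horizontal? v u) (λ (_ , dv≡du) → <-irrefl dv≡du (≤-reflexive 1+dv≡du))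
            | 𝟙-yes (Parent? v u) (a , 1+dv≡du) = refl
    ...   | inj₂ (inj₁ (a , dv≡du))
      rewrite 𝟙-no (Parent? u v) (λ (_ , 1+du≡dv) → <-irrefl (sym dv≡du) (≤-reflexive 1+du≡dv))
            | 𝟙-yes (Horizontal? v u) (a , dv≡du)
            | 𝟙-no (Parent? v u) (λ (_ , 1+dv≡du) → <-irrefl dv≡du (≤-reflexive 1+dv≡du)) = refl
    ...   | inj₂ (inj₂ (a′ , 1+du≡dv))
      rewrite 𝟙-yes (Parent? u v) (a′ , 1+du≡dv)
            | 𝟙-no (Horizontal? v u) (λ (_ , dv≡du) → <-irrefl (sym dv≡du) (≤-reflexive 1+du≡dv))
            | 𝟙-no (Parent? v u) (λ (_ , 1+dv≡du) → <-asym (≤-reflexive 1+dv≡du) (≤-reflexive 1+du≡dv)) = refl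

  ∑-children≡∑-parents : sum #children ≡ sum #parents
  ∑-children≡∑-parents = ∑-comm (λ v u → 𝟙 (Parent? v u))

  #parents-root : #parents r ≡ 0
  #parents-root = count-none (λ u → Parent? u r) (λ u (_ , 1+du≡dr) → contradiction (trans 1+du≡dr dist-root) λ ())

  #parents-≥1 : ∀ {v} → v ≢ r → 1 ≤ #parents v
  #parents-≥1 v≢r = count-≥-1 (λ u → Parent? u _) (proj₂ (parent-exists v≢r))

  parent-unique : ∀ {u w v} → #parents v ≤ 1 → Parent u v → Parent w v → u ≡ w
  parent-unique {u} {w} #≤1 pu pw with u ≟ w
  ... | yes u≡w = u≡w
  ... | no u≢w  = contradiction (≤-trans (count-≥-2 (λ u → Parent? u _) pu pw u≢w) #≤1) (<-irrefl refl)

module Excess (G : Graph n) (r : Fin n) (connected : Connected G) (m≤n : numEdges G ≤ n) where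

  open BreadthFirst G r connected

  -- sum surplus = 2 (m − n + 1): each edge outside a BFS tree either is a second parent edge of
  -- a vertex or is horizontal and counted at both of its ends.
  surplus : Fin n → ℕ
  surplus v = (#parents v ∸ 1) + (#parents v ∸ 1) + #horizontal v

  ∑-degree-levels : sum (degree G) ≡ sum #parents + sum #horizontal + sum #parents
  ∑-degree-levels = begin
    sum (degree G)                                          ≡⟨ sum-cong-≗ degree-split ⟩
    sum (λ v → #parents v + #horizontal v + #children v)    ≡⟨ ∑-distrib-+ (λ v → #parents v + #horizontal v) #children ⟩
    sum (λ v → #parents v + #horizontal v) + sum #children  ≡⟨ cong₂ _+_ (∑-distrib-+ #parents #horizontal) ∑-children≡∑-parents ⟩
    sum #parents + sum #horizontal + sum #parents           ∎
    where open ≡-Reasoning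

  ∑-parents : sum #parents + 1 ≡ n + sum (λ v → #parents v ∸ 1)
  ∑-parents = begin
    sum #parents + 1                                ≡⟨ cong (sum #parents +_) (sym (count-≟ r)) ⟩
    sum #parents + count (_≟ r)                     ≡⟨ sym (∑-distrib-+ #parents (λ v → 𝟙 (v ≟ r))) ⟩
    sum (λ v → #parents v + 𝟙 (v ≟ r))              ≡⟨ sum-cong-≗ pointwise ⟩
    sum (λ v → 1 + (#parents v ∸ 1))                ≡⟨ ∑-distrib-+ (λ _ → 1) (λ v → #parents v ∸ 1) ⟩
    sum {n} (λ _ → 1) + sum (λ v → #parents v ∸ 1)  ≡⟨ cong (_+ sum (λ v → #parents v ∸ 1)) (∑-const-1 n) ⟩
    n + sum (λ v → #parents v ∸ 1)                  ∎
    where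
    open ≡-Reasoning
    pointwise : ∀ v → #parents v + 𝟙 (v ≟ r) ≡ 1 + (#parents v ∸ 1)
    pointwise v with v ≟ r
    ... | yes refl rewrite #parents-root = refl
    ... | no v≢r   = trans (+-identityʳ _) (sym (m+[n∸m]≡n (#parents-≥1 v≢r)))

  ∑-surplus≤2 : sum surplus ≤ 2
  ∑-surplus≤2 = +-cancelˡ-≤ (n + n) _ _ (begin
    n + n + sum surplus          ≡⟨ cong (n + n +_) ∑-surplus ⟩
    n + n + (E + E + S)          ≡⟨ rearrange₁ n E S ⟩
    (n + E) + S + (n + E)        ≡⟨ cong (λ t → t + S + t) (sym ∑-parents) ⟩
    (U + 1) + S + (U + 1)        ≡⟨ rearrange₂ U S ⟩
    (U + S + U) + 2              ≡⟨ cong (_+ 2) (sym ∑-degree-levels) ⟩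
    sum (degree G) + 2           ≡⟨ cong (_+ 2) (handshake G) ⟩
    numEdges G + numEdges G + 2  ≤⟨ +-monoˡ-≤ 2 (+-mono-≤ m≤n m≤n) ⟩
    n + n + 2                    ∎)
    where
    open ≤-Reasoning
    U S E : ℕ
    U = sum #parents
    S = sum #horizontal
    E = sum (λ v → #parents v ∸ 1)
    ∑-surplus : sum surplus ≡ E + E + S
    ∑-surplus = trans (∑-distrib-+ (λ v → (#parents v ∸ 1) + (#parents v ∸ 1)) #horizontal)
                      (cong (_+ S) (∑-distrib-+ (λ v → #parents v ∸ 1) (λ v → #parents v ∸ 1)))
    rearrange₁ : ∀ a e s → a + a + (e + e + s) ≡ (a + e) + s + (a + e)
    rearrange₁ = solve-∀
    rearrange₂ : ∀ u s → (u + 1) + s + (u + 1) ≡ (u + s + u) + 2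
    rearrange₂ = solve-∀

  surplus-≥ : ∀ {v a b} → a ≤ #parents v ∸ 1 → b ≤ #horizontal v → a + a + b ≤ surplus v
  surplus-≥ a≤ b≤ = +-mono-≤ (+-mono-≤ a≤ a≤) b≤

  surplus≤2 : ∀ v → surplus v ≤ 2
  surplus≤2 v = ≤-trans (∑-≥-point surplus v) ∑-surplus≤2

  #parents≤2 : ∀ v → #parents v ≤ 2
  #parents≤2 v = ≤-trans (m≤n+m∸n (#parents v) 1) (s≤s (half (≤-trans (m≤m+n _ _) (surplus≤2 v))))
    where
    half : ∀ {a} → a + a ≤ 2 → a ≤ 1
    half {zero}        _ = z≤n
    half {suc zero}    _ = ≤-refl
    half {suc (suc a)} (s≤s (s≤s a+2+a≤0)) = contradiction (m+n≤o⇒n≤o a a+2+a≤0) λ ()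

  two-parents-unique : ∀ {x w} → 2 ≤ #parents x → 2 ≤ #parents w → x ≡ w
  two-parents-unique {x} {w} 2≤px 2≤pw with x ≟ w
  ... | yes x≡w = x≡w
  ... | no x≢w  = contradiction (≤-trans (+-mono-≤ (surplus-≥ {x} (∸-monoˡ-≤ 1 2≤px) (z≤n {#horizontal x}))
                                                   (surplus-≥ {w} (∸-monoˡ-≤ 1 2≤pw) (z≤n {#horizontal w})))
                                         (≤-trans (∑-≥-pair surplus x≢w) ∑-surplus≤2)) λ { (s≤s (s≤s ())) }

  two-parents-excludes-horizontal : ∀ {x w} → 2 ≤ #parents x → 1 ≤ #horizontal w → ⊥
  two-parents-excludes-horizontal {x} {w} 2≤px 1≤hw with x ≟ w
  ... | yes refl = contradiction (≤-trans (surplus-≥ (∸-monoˡ-≤ 1 2≤px) 1≤hw) (surplus≤2 x)) λ { (s≤s (s≤s ())) }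
  ... | no x≢w   = contradiction (≤-trans (+-mono-≤ (surplus-≥ {x} (∸-monoˡ-≤ 1 2≤px) (z≤n {#horizontal x}))
                                                     (surplus-≥ {w} (z≤n {#parents w ∸ 1}) 1≤hw))
                                           (≤-trans (∑-≥-pair surplus x≢w) ∑-surplus≤2)) λ { (s≤s (s≤s ())) }

  horizontal-at-most-two : ∀ {x y z} → x ≢ y → x ≢ z → y ≢ z →
                           1 ≤ #horizontal x → 1 ≤ #horizontal y → 1 ≤ #horizontal z → ⊥
  horizontal-at-most-two {x} {y} {z} x≢y x≢z y≢z 1≤hx 1≤hy 1≤hz =
    contradiction (≤-trans (+-mono-≤ (+-mono-≤ (≥h 1≤hx) (≥h 1≤hy)) (≥h 1≤hz))
                           (≤-trans (∑-≥-triple surplus x≢y x≢z y≢z) ∑-surplus≤2)) λ { (s≤s (s≤s ())) }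
    where
    ≥h : ∀ {v} → 1 ≤ #horizontal v → 1 ≤ surplus v
    ≥h {v} = surplus-≥ {v} (z≤n {#parents v ∸ 1})

module Colouring (G : Graph n) (r : Fin n) (connected : Connected G) (m≤n : numEdges G ≤ n) where

  open BreadthFirst G r connected
  open Excess G r connected m≤n

  Special : Fin n → Set
  Special v = 2 ≤ #parents v ⊎ 1 ≤ #horizontal v

  Special? : ∀ v → Dec (Special v)
  Special? v = (2 ≤? #parents v) ⊎-dec (1 ≤? #horizontal v)

  -- Within a level the special vertices (where a cycle closes) are coloured first.
  key : Fin n → ℕ
  key v with Special? v
  ... | yes _ = toℕ v
  ... | no _  = n + toℕ v

  rank : Fin n → ℕ
  rank v = dist v * (n + n) + key v

  key<2n : ∀ v → key v < n + n
  key<2n v with Special? v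
  ... | yes _ = ≤-trans (toℕ<n v) (m≤m+n n n)
  ... | no _  = +-monoʳ-< n (toℕ<n v)

  key<n⇒Special : ∀ {v} → key v < n → Special v
  key<n⇒Special {v} k<n with Special? v
  ... | yes sv = sv
  ... | no _   = contradiction k<n (≤⇒≯ (m≤m+n n (toℕ v)))

  Special⇒key<n : ∀ {v} → Special v → key v < n
  Special⇒key<n {v} sv with Special? v
  ... | yes _  = toℕ<n v
  ... | no ¬sv = contradiction sv ¬sv

  key-injective : ∀ {x y} → key x ≡ key y → x ≡ y
  key-injective {x} {y} kx≡ky with Special? x | Special? y
  ... | yes _ | yes _ = toℕ-injective kx≡ky
  ... | no _  | no _  = toℕ-injective (+-cancelˡ-≡ n _ _ kx≡ky)
  ... | yes _ | no _  = contradiction (subst (_< n) kx≡ky (toℕ<n x)) (≤⇒≯ (m≤m+n n (toℕ y)))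
  ... | no _  | yes _ = contradiction (subst (_< n) (sym kx≡ky) (toℕ<n y)) (≤⇒≯ (m≤m+n n (toℕ x)))

  dist<⇒rank< : ∀ {x y} → dist y < dist x → rank y < rank x
  dist<⇒rank< {x} {y} = *+-<-lex (key<2n y)

  rank<⇒dist≤ : ∀ {x y} → rank y < rank x → dist y ≤ dist x
  rank<⇒dist≤ ry<rx = ≮⇒≥ (<-asym ry<rx ∘ dist<⇒rank<)

  rank<⇒key< : ∀ {x y} → rank y < rank x → dist y ≡ dist x → key y < key x
  rank<⇒key< {x} {y} ry<rx dy≡dx = +-cancelˡ-< (dist x * (n + n)) _ _ (subst (λ d → d * (n + n) + key y < rank x) dy≡dx ry<rx)

  rank-injective : ∀ {x y} → rank x ≡ rank y → x ≡ y
  rank-injective {x} {y} rx≡ry with <-cmp (dist x) (dist y)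
  ... | tri< dx<dy _ _ = contradiction rx≡ry (<⇒≢ (dist<⇒rank< dx<dy))
  ... | tri> _ _ dy<dx = contradiction (sym rx≡ry) (<⇒≢ (dist<⇒rank< dy<dx))
  ... | tri≈ _ dx≡dy _ = key-injective (+-cancelˡ-≡ (dist x * (n + n)) _ _ (subst (λ d → rank x ≡ d * (n + n) + key y) (sym dx≡dy) rx≡ry))

  rank-trichotomy : ∀ {x y} → x ≢ y → rank y < rank x ⊎ rank x < rank y
  rank-trichotomy {x} {y} x≢y with <-cmp (rank y) (rank x)
  ... | tri< ry<rx _ _ = inj₁ ry<rx
  ... | tri> _ _ rx<ry = inj₂ rx<ry
  ... | tri≈ _ ry≡rx _ = contradiction (sym (rank-injective ry≡rx)) x≢y

  rank<⇒Special : ∀ {x y} → rank y < rank x → dist y ≡ dist x → Special x → Special y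
  rank<⇒Special ry<rx dy≡dx sx = key<n⇒Special (<-trans (rank<⇒key< ry<rx dy≡dx) (Special⇒key<n sx))

  Siblings : Fin n → Fin n → Set
  Siblings y x = ∃ λ u → Parent u y × Parent u x

  Conflict : Fin n → Fin n → Set
  Conflict y x = Adj G y x ⊎ Siblings y x

  Conflict-sym : ∀ {x y} → Conflict y x → Conflict x y
  Conflict-sym (inj₁ a)                = inj₁ (Adj-sym G a)
  Conflict-sym (inj₂ (u , pu-y , pu-x)) = inj₂ (u , pu-x , pu-y)

  Siblings⇒same-dist : ∀ {x y} → Siblings y x → dist y ≡ dist x
  Siblings⇒same-dist (_ , (_ , 1+du≡dy) , (_ , 1+du≡dx)) = trans (sym 1+du≡dy) 1+du≡dx

  Earlier : Fin n → Fin n → Set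
  Earlier x y = y ≢ r × rank y < rank x × Conflict y x

  Earlier? : ∀ x y → Dec (Earlier x y)
  Earlier? x y = ¬? (y ≟ r) ×-dec (rank y <? rank x) ×-dec
                 (Adj? G y x ⊎-dec any? (λ u → Parent? u y ×-dec Parent? u x))

  open Greedy Earlier? rank (proj₁ ∘ proj₂)

  earlier-adjacent : ∀ {x y} → rank y < rank x → Adj G y x → Parent y x ⊎ Horizontal x y
  earlier-adjacent {x} {y} ry<rx a with adjacent-levels a
  ... | inj₁ p                    = inj₁ p
  ... | inj₂ (inj₁ (_ , dy≡dx))   = inj₂ (Adj-sym G a , sym dy≡dx)
  ... | inj₂ (inj₂ (_ , 1+dx≡dy)) = contradiction (rank<⇒dist≤ ry<rx) (<⇒≱ (≤-reflexive 1+dx≡dy))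

  Horizontal⇒#horizontal : ∀ {x y} → Horizontal x y → 1 ≤ #horizontal x
  Horizontal⇒#horizontal {x} = count-≥-1 (Horizontal? x)

  Horizontal-sym : ∀ {x y} → Horizontal x y → Horizontal y x
  Horizontal-sym (a , dx≡dy) = Adj-sym G a , sym dx≡dy

  Δ : ℕ
  Δ = maxDegree G

  earlier-two-parents : ∀ {x y} → 2 ≤ #parents x → Earlier x y → Parent y x
  earlier-two-parents 2≤px (_ , ry<rx , inj₁ a) with earlier-adjacent ry<rx a
  ... | inj₁ p = p
  ... | inj₂ h = ⊥-elim (two-parents-excludes-horizontal 2≤px (Horizontal⇒#horizontal h))
  earlier-two-parents 2≤px (_ , ry<rx , inj₂ s) with rank<⇒Special ry<rx (Siblings⇒same-dist s) (inj₁ 2≤px)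
  ... | inj₁ 2≤py  = contradiction (cong rank (sym (two-parents-unique 2≤px 2≤py))) (<⇒≢ ry<rx)
  ... | inj₂ 1≤hy  = ⊥-elim (two-parents-excludes-horizontal 2≤px 1≤hy)

  earlier-one-parent : ∀ {x u₀ y} → #parents x ≤ 1 → #horizontal x ≡ 0 → Parent u₀ x →
                       Earlier x y → (y ≡ u₀ × y ≢ r) ⊎ (Parent u₀ y × y ≢ x)
  earlier-one-parent p≤1 h≡0 p₀ (y≢r , ry<rx , inj₁ a) with earlier-adjacent ry<rx a
  ... | inj₁ p = inj₁ (parent-unique p≤1 p p₀ , y≢r)
  ... | inj₂ h = contradiction (subst (1 ≤_) h≡0 (Horizontal⇒#horizontal h)) λ ()
  earlier-one-parent p≤1 h≡0 p₀ (_ , ry<rx , inj₂ (u , pu-y , pu-x)) =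
    inj₂ (subst (λ w → Parent w _) (parent-unique p≤1 pu-x p₀) pu-y , <⇒≢ ry<rx ∘ cong rank)

  earlier-bound-one-parent : ∀ {x u₀} → #parents x ≤ 1 → #horizontal x ≡ 0 → Parent u₀ x →
                             suc (count (Earlier? x)) ≤ Δ
  earlier-bound-one-parent {x} {u₀} p≤1 h≡0 p₀ = begin
    suc (count (Earlier? x))
      ≤⟨ s≤s (count-⊆-∪ (Earlier? x) NonrootParent? Sibling? (earlier-one-parent p≤1 h≡0 p₀)) ⟩
    suc (count NonrootParent? + count Sibling?)  ≡⟨ sym (+-suc _ _) ⟩
    count NonrootParent? + suc (count Sibling?)  ≤⟨ +-mono-≤ nonroot-parent≤#parents (count-without (Parent? u₀) p₀) ⟩
    #parents u₀ + #children u₀                   ≤⟨ +-monoˡ-≤ (#children u₀) (m≤m+n (#parents u₀) (#horizontal u₀)) ⟩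
    #parents u₀ + #horizontal u₀ + #children u₀  ≡⟨ sym (degree-split u₀) ⟩
    degree G u₀                                  ≤⟨ degree≤maxDegree G u₀ ⟩
    Δ                                            ∎
    where
    open ≤-Reasoning
    NonrootParent? : ∀ y → Dec (y ≡ u₀ × y ≢ r)
    NonrootParent? y = (y ≟ u₀) ×-dec ¬? (y ≟ r)
    Sibling? : ∀ y → Dec (Parent u₀ y × y ≢ x)
    Sibling? y = Parent? u₀ y ×-dec ¬? (y ≟ x)
    nonroot-parent≤#parents : count NonrootParent? ≤ #parents u₀
    nonroot-parent≤#parents with u₀ ≟ r
    ... | yes refl = ≤-reflexive (trans (count-none NonrootParent? λ _ (y≡r , y≢r) → y≢r y≡r) (sym #parents-root))
    ... | no u₀≢r  = ≤-trans (count-mono NonrootParent? (_≟ u₀) proj₁) (≤-trans (≤-reflexive (count-≟ u₀)) (#parents-≥1 u₀≢r))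

  Special⇒horizontal-neighbour : ∀ {x z y} → Horizontal x z → Special y → y ≢ x → y ≡ z
  Special⇒horizontal-neighbour hxz (inj₁ 2≤py) _ = ⊥-elim (two-parents-excludes-horizontal 2≤py (Horizontal⇒#horizontal hxz))
  Special⇒horizontal-neighbour {x} {z} {y} hxz (inj₂ 1≤hy) y≢x with y ≟ z
  ... | yes y≡z = y≡z
  ... | no y≢z  = ⊥-elim (horizontal-at-most-two x≢z (y≢x ∘ sym) (y≢z ∘ sym)
                           (Horizontal⇒#horizontal hxz) (Horizontal⇒#horizontal (Horizontal-sym hxz)) 1≤hy)
    where
    x≢z : x ≢ z
    x≢z refl = Adj-irrefl G (proj₁ hxz)

  earlier-horizontal : ∀ {x u₀ z y} → #parents x ≤ 1 → Parent u₀ x → Horizontal x z →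
                       Earlier x y → y ≡ u₀ ⊎ y ≡ z
  earlier-horizontal p≤1 p₀ hxz (_ , ry<rx , inj₁ a) with earlier-adjacent ry<rx a
  ... | inj₁ p = inj₁ (parent-unique p≤1 p p₀)
  ... | inj₂ h = inj₂ (Special⇒horizontal-neighbour hxz (inj₂ (Horizontal⇒#horizontal (Horizontal-sym h))) (<⇒≢ ry<rx ∘ cong rank))
  earlier-horizontal p≤1 p₀ hxz (_ , ry<rx , inj₂ s) =
    inj₂ (Special⇒horizontal-neighbour hxz (rank<⇒Special ry<rx (Siblings⇒same-dist s) (inj₂ (Horizontal⇒#horizontal hxz)))
                                  (<⇒≢ ry<rx ∘ cong rank))

  at-most-two⇒bound : ∀ {x} {a b : Fin n} → 3 ≤ Δ → (∀ {y} → Earlier x y → y ≡ a ⊎ y ≡ b) → suc (count (Earlier? x)) ≤ Δ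
  at-most-two⇒bound {x} {a} {b} 3≤Δ ⊆a∪b = ≤-trans (s≤s (≤-trans (count-⊆-∪ (Earlier? x) (_≟ a) (_≟ b) ⊆a∪b)
                                                   (≤-reflexive (cong₂ _+_ (count-≟ a) (count-≟ b))))) 3≤Δ

  earlier-bound : 3 ≤ Δ → ∀ {x} → x ≢ r → suc (count (Earlier? x)) ≤ Δ
  earlier-bound 3≤Δ {x} x≢r = by-cases (parent-exists x≢r) (2 ≤? #parents x) (#horizontal x ℕ.≟ 0)
    where
    by-cases : ∃ (λ u → Parent u x) → Dec (2 ≤ #parents x) → Dec (#horizontal x ≡ 0) →
               suc (count (Earlier? x)) ≤ Δ
    by-cases _ (yes 2≤px) _ =
      ≤-trans (s≤s (≤-trans (count-mono (Earlier? x) (λ y → Parent? y x) (earlier-two-parents 2≤px))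
                            (#parents≤2 x)))
              3≤Δ
    by-cases (u₀ , p₀) (no 2≰px) (yes h≡0) = earlier-bound-one-parent (s≤s⁻¹ (≰⇒> 2≰px)) h≡0 p₀
    by-cases (u₀ , p₀) (no 2≰px) (no h≢0)  =
      let z , hxz = count-witness (Horizontal? x) (n≢0⇒n>0 h≢0) in
      at-most-two⇒bound 3≤Δ (earlier-horizontal (s≤s⁻¹ (≰⇒> 2≰px)) p₀ hxz)

  label : Fin n → ℕ
  label x with x ≟ r
  ... | yes _ = 0
  ... | no _  = colour x

  label-root : label r ≡ 0
  label-root with r ≟ r
  ... | yes _   = refl
  ... | no r≢r = contradiction refl r≢r

  label≡0⇒root : ∀ {x} → label x ≡ 0 → x ≡ r
  label≡0⇒root {x} lx≡0 with x ≟ r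
  ... | yes x≡r = x≡r
  ... | no _    = contradiction lx≡0 (≢-sym (<⇒≢ (colour-≥1 x)))

  label≤Δ : 3 ≤ Δ → ∀ x → label x ≤ Δ
  label≤Δ 3≤Δ x with x ≟ r
  ... | yes _   = z≤n
  ... | no x≢r  = ≤-trans (colour-≤ x) (earlier-bound 3≤Δ x≢r)

  colour-separates : ∀ {x y} → x ≢ r → y ≢ r → x ≢ y → Conflict y x → colour x ≢ colour y
  colour-separates {x} {y} x≢r y≢r x≢y c =
    [ (λ ry<rx → colour-≢ {x} {y} (y≢r , ry<rx , c))
    , (λ rx<ry → ≢-sym (colour-≢ {y} {x} (x≢r , rx<ry , Conflict-sym c)))
    ]′ (rank-trichotomy x≢y)

  label-separates : ∀ {x y} → x ≢ y → Conflict y x → label x ≢ label y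
  label-separates {x} {y} x≢y c with x ≟ r | y ≟ r
  ... | yes x≡r | yes y≡r = contradiction (trans x≡r (sym y≡r)) x≢y
  ... | yes _   | no _    = <⇒≢ (colour-≥1 y)
  ... | no _    | yes _   = ≢-sym (<⇒≢ (colour-≥1 x))
  ... | no x≢r  | no y≢r  = colour-separates x≢r y≢r x≢y c

  labelling : 3 ≤ Δ → Labeling n (Δ + 1)
  labelling 3≤Δ x = fromℕ< (≤-trans (s≤s (label≤Δ 3≤Δ x)) (≤-reflexive (+-comm 1 Δ)))

  module _ (3≤Δ : 3 ≤ Δ) where

    labelling≡⇒label≡ : ∀ {x y} → labelling 3≤Δ x ≡ labelling 3≤Δ y → label x ≡ label y
    labelling≡⇒label≡ e = trans (sym (toℕ-fromℕ< _)) (trans (cong toℕ e) (toℕ-fromℕ< _))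

    labelling-proper : Proper G (labelling 3≤Δ)
    labelling-proper u v a =
      label-separates {u} {v} (λ { refl → Adj-irrefl G a }) (inj₁ (Adj-sym G a)) ∘ labelling≡⇒label≡ {u} {v}

    labelling-distinguishing : Distinguishing G (labelling 3≤Δ)
    labelling-distinguishing (σ , σ-adj) σ-labels x = fixed-below (suc (dist x)) x ≤-refl
      where
      open Inverse σ using (to)

      label-invariant : ∀ x → label (to x) ≡ label x
      label-invariant x = labelling≡⇒label≡ {to x} {x} (σ-labels x)

      -- Above the level of x, to x would be fixed and hence equal to x by injectivity;
      -- on the level of x it is a sibling of x carrying the same label.
      fixed-by-parent : ∀ {x u₀ b} → Parent u₀ x → (∀ y → dist y < b → to y ≡ y) → dist x ≤ b → to x ≡ x
      fixed-by-parent {x} {u₀} {b} (a₀ , 1+du₀≡dx) fixed dx≤b = by-level (m≤n⇒m<n∨m≡n dσx≤dx)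
        where
        a′ : Adj G u₀ (to x)
        a′ = trans (cong (λ w → adj G w (to x)) (sym (fixed u₀ (≤-trans (≤-reflexive 1+du₀≡dx) dx≤b))))
                   (trans (σ-adj u₀ x) a₀)
        dσx≤dx : dist (to x) ≤ dist x
        dσx≤dx = subst (dist (to x) ≤_) 1+du₀≡dx (dist-adj a′)
        by-level : dist (to x) < dist x ⊎ dist (to x) ≡ dist x → to x ≡ x
        by-level (inj₁ dσx<dx) = contradiction (cong dist (Injection.injective (Inverse⇒Injection σ)
                                                              (fixed (to x) (<-≤-trans dσx<dx dx≤b))))
                                               (<⇒≢ dσx<dx)
        by-level (inj₂ dσx≡dx) = decidable-stable (to x ≟ x) λ σx≢x →
          label-separates {x} {to x} (≢-sym σx≢x) (inj₂ (u₀ , (a′ , trans 1+du₀≡dx (sym dσx≡dx)) , (a₀ , 1+du₀≡dx)))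
                          (sym (label-invariant x))

      fixed-below : ∀ b x → dist x < b → to x ≡ x
      fixed-below (suc b) x dx<1+b with x ≟ r
      ... | yes refl = label≡0⇒root (trans (label-invariant r) label-root)
      ... | no x≢r   = fixed-by-parent (proj₂ (parent-exists x≢r)) (fixed-below b) (s≤s⁻¹ dx<1+b)

mainTheorem2 : ∀ (n : ℕ) (G : Graph n) → Connected G →
    numEdges G ≤ n → 3 ≤ maxDegree G →
    χD≤ G (maxDegree G + 1)
mainTheorem2 zero    G connected m≤n ()
mainTheorem2 (suc n) G connected m≤n 3≤Δ =
  labelling 3≤Δ , labelling-proper 3≤Δ , labelling-distinguishing 3≤Δ
  where open Colouring G zero connected m≤n
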